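{- For every integer $n\geq 4$ and every $\pi\in K_n$, either $[2413]\preceq\pi$ or $[3142]\preceq\pi$.
   Context: Permutations are written in one-line notation $\sigma=[\sigma_1,\dots,\sigma_n]\in S_n$. A king permutation is a permutation $\sigma\in S_n$ with $|\sigma_i-\sigma_{i-1}|\neq 1$ for all $2\leq i\leq n$; $K_n$ denotes the set of king permutations in $S_n$. For permutations $\pi,\sigma$, we write $\pi\preceq\sigma$ ($\sigma$ contains $\pi$) if some subsequence of the one-line notation of $\sigma$ is order-isomorphic to the one-line notation of $\pi$. -}

module Defs where

open import Data.Nat using (ℕ; zero; suc; _<_)
open import Data.Fin using (Fin; toℕ)
import Data.Fin as Fin
open import Data.Fin.Permutation using (Permutation′; _⟨$⟩ʳ_)
open import Data.Product using (Σ; _×_)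
open import Relation.Binary.PropositionalEquality using (_≡_)
open import Relation.Nullary using (¬_)
open import Function.Bundles using (_⇔_; mk↔ₛ′)
open import Relation.Binary.PropositionalEquality using (refl)

-- Permutations of [n], encoded 0-based on Fin n; the one-line notation is
-- σ_i = σ ⟨$⟩ʳ i for positions i = 0,…,n-1.

∣_-_∣ : ℕ → ℕ → ℕ
∣ zero  - n     ∣ = n
∣ suc m - zero  ∣ = suc m
∣ suc m - suc n ∣ = ∣ m - n ∣

val : ∀ {n} → Permutation′ n → Fin n → ℕ
val σ i = toℕ (σ ⟨$⟩ʳ i)

IsKing : ∀ {n} → Permutation′ n → Set
IsKing {n} σ = (i j : Fin n) → toℕ j ≡ suc (toℕ i) → ¬ (∣ val σ j - val σ i ∣ ≡ 1)

_⪯_ : ∀ {k n} → Permutation′ k → Permutation′ n → Set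
_⪯_ {k} {n} π σ =
  Σ (Fin k → Fin n) λ f →
    ((a b : Fin k) → toℕ a < toℕ b → toℕ (f a) < toℕ (f b)) ×
    ((a b : Fin k) → (val π a < val π b) ⇔ (val σ (f a) < val σ (f b)))

-- p2413 (0-based one-line [1,3,0,2]) and p3142 (0-based [2,0,3,1]);
-- they are mutually inverse.
f2413 : Fin 4 → Fin 4
f2413 Fin.zero = Fin.suc Fin.zero
f2413 (Fin.suc Fin.zero) = Fin.suc (Fin.suc (Fin.suc Fin.zero))
f2413 (Fin.suc (Fin.suc Fin.zero)) = Fin.zero
f2413 (Fin.suc (Fin.suc (Fin.suc Fin.zero))) = Fin.suc (Fin.suc Fin.zero)

f3142 : Fin 4 → Fin 4
f3142 Fin.zero = Fin.suc (Fin.suc Fin.zero)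
f3142 (Fin.suc Fin.zero) = Fin.zero
f3142 (Fin.suc (Fin.suc Fin.zero)) = Fin.suc (Fin.suc (Fin.suc Fin.zero))
f3142 (Fin.suc (Fin.suc (Fin.suc Fin.zero))) = Fin.suc Fin.zero

inv₁ : ∀ x → f2413 (f3142 x) ≡ x
inv₁ Fin.zero = refl
inv₁ (Fin.suc Fin.zero) = refl
inv₁ (Fin.suc (Fin.suc Fin.zero)) = refl
inv₁ (Fin.suc (Fin.suc (Fin.suc Fin.zero))) = refl

inv₂ : ∀ x → f3142 (f2413 x) ≡ x
inv₂ Fin.zero = refl
inv₂ (Fin.suc Fin.zero) = refl
inv₂ (Fin.suc (Fin.suc Fin.zero)) = refl
inv₂ (Fin.suc (Fin.suc (Fin.suc Fin.zero))) = refl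

p2413 : Permutation′ 4
p2413 = mk↔ₛ′ f2413 f3142 inv₁ inv₂

p3142 : Permutation′ 4
p3142 = mk↔ₛ′ f3142 f2413 inv₂ inv₁

-- A permutation avoiding 2413 and 3142 is separable: every segment of
-- length at least two whose values form an interval splits into a left
-- block lying entirely below (or entirely above) the right block, and
-- both blocks are again intervals. Descending into a block of length at
-- least two, one ends at an interval of length exactly two: two adjacent
-- positions with consecutive values, which a king permutation forbids.
-- To split a segment [a, c] with σ_a < σ_c, cut before the first entry t
-- that is not below σ_c; if some p before the cut lies above some q after
-- it, then p t q c is an occurrence of 2413. The case σ_a > σ_c is the
-- mirror image and produces 3142.
module Submission where

open import Defs
open import Data.Nat using (ℕ; _≤_)
open import Data.Fin.Permutation using (Permutation′)
open import Data.Sum using (_⊎_)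

open import Data.Nat using (zero; suc; _+_; _<_; _≤?_; _<?_; z≤n; s≤s; s≤s⁻¹)
open import Data.Nat.Properties
  using ( ≤-refl; ≤-trans; ≤-antisym; ≤-reflexive; <-trans; <-irrefl; <-asym
        ; <⇒≤; <⇒≢; ≤∧≢⇒<; ≰⇒>; ≮⇒≥; 1+n≰n; n<1+n; n≤1+n; m≤n⇒m<n∨m≡n
        ; <-≤-trans; ≤-<-trans; <-cmp; +-suc; +-identityʳ; +-monoʳ-≤
        ; <-isStrictTotalOrder; anyUpTo? )
open import Data.Nat.Induction using (<-rec)
open import Data.Fin using (Fin; toℕ; fromℕ<)
open import Data.Fin.Patterns using (0F; 1F; 2F; 3F)
open import Data.Fin.Properties using (toℕ-injective; toℕ<n; toℕ-fromℕ<; fromℕ<-toℕ)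
open import Data.Fin.Permutation using (_⟨$⟩ʳ_; _⟨$⟩ˡ_; inverseˡ; inverseʳ)
open import Data.Vec using (_∷_; []; lookup)
open import Data.Sum using (inj₁; inj₂; swap)
open import Data.Product using (_×_; _,_; ∃-syntax)
open import Data.Empty using (⊥-elim)
open import Function using (_∘_; flip)
open import Function.Bundles using (mk⇔)
open import Relation.Binary using (IsStrictTotalOrder; tri<; tri≈; tri>)
import Relation.Binary.Construct.Flip.EqAndOrd as Flip
open import Relation.Binary.PropositionalEquality
open import Relation.Nullary using (¬_; yes; no; contradiction)
open import Relation.Nullary.Decidable using (decidable-stable; _×-dec_; ¬?)
open import Relation.Unary using (Decidable)

Minimal : (ℕ → Set) → ℕ → Set
Minimal P t = P t × (∀ {i} → i < t → ¬ P i)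

minimal-witness : {P : ℕ → Set} → Decidable P → ∀ {c} → P c → ∃[ t ] t ≤ c × Minimal P t
minimal-witness {P} P? {c} = <-rec (λ c → P c → ∃[ t ] t ≤ c × Minimal P t) step c
  where
  step : ∀ c → (∀ {i} → i < c → P i → ∃[ t ] t ≤ i × Minimal P t) →
         P c → ∃[ t ] t ≤ c × Minimal P t
  step c smaller Pc with anyUpTo? P? c
  ... | no ¬∃ = c , ≤-refl , Pc , λ i<c Pi → ¬∃ (_ , i<c , Pi)
  ... | yes (i , i<c , Pi) with smaller i<c Pi
  ...   | t , t≤i , minimal = t , ≤-trans t≤i (<⇒≤ i<c) , minimal

Consecutive : ℕ → ℕ → Set
Consecutive x y = y ≡ suc x ⊎ x ≡ suc y

∣1+m-m∣≡1 : ∀ m → ∣ suc m - m ∣ ≡ 1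
∣1+m-m∣≡1 zero    = refl
∣1+m-m∣≡1 (suc m) = ∣1+m-m∣≡1 m

∣m-1+m∣≡1 : ∀ m → ∣ m - suc m ∣ ≡ 1
∣m-1+m∣≡1 zero    = refl
∣m-1+m∣≡1 (suc m) = ∣m-1+m∣≡1 m

consecutive⇒∣-∣≡1 : ∀ {x y} → Consecutive x y → ∣ y - x ∣ ≡ 1
consecutive⇒∣-∣≡1 {x} (inj₁ refl) = ∣1+m-m∣≡1 x
consecutive⇒∣-∣≡1 {y = y} (inj₂ refl) = ∣m-1+m∣≡1 y

module Segments (g : ℕ → ℕ) (N : ℕ)
                (g-injective : ∀ {i j} → i < N → j < N → g i ≡ g j → i ≡ j) where

  IsInterval : ℕ → ℕ → Set
  IsInterval a b = ∀ {i j z} → a ≤ i → i < b → a ≤ j → j < b → g i < z → z < g j →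
                   ∃[ k ] a ≤ k × k < b × g k ≡ z

  Below : (ℕ → ℕ → Set) → ℕ → ℕ → ℕ → Set
  Below _≺_ a t b = ∀ {p q} → a ≤ p → p < t → t ≤ q → q < b → g p ≺ g q

  Separated : ℕ → ℕ → ℕ → Set
  Separated a t b = Below _<_ a t b ⊎ Below (flip _<_) a t b

  -- Occurrence _<_ is an occurrence of 2413, Occurrence (flip _<_) one of 3142.
  Occurrence : (ℕ → ℕ → Set) → Set
  Occurrence _≺_ = ∃[ i ] ∃[ j ] ∃[ k ] ∃[ l ]
    i < j × j < k × k < l × l < N × g k ≺ g i × g i ≺ g l × g l ≺ g j

  AdjacentConsecutive : Set
  AdjacentConsecutive = ∃[ i ] suc i < N × Consecutive (g i) (g (suc i))

  module Oriented {_≺_ : ℕ → ℕ → Set} (≺-isStrictTotalOrder : IsStrictTotalOrder _≡_ _≺_) where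
    open IsStrictTotalOrder ≺-isStrictTotalOrder
      using (compare; irrefl; asym) renaming (trans to ≺-trans; _<?_ to _≺?_)

    ≺-connex : ∀ {i j} → i < N → j < N → i ≢ j → ¬ (g i ≺ g j) → g j ≺ g i
    ≺-connex i<N j<N i≢j gi⊀gj with compare (g _) (g _)
    ... | tri< gi≺gj _ _ = contradiction gi≺gj gi⊀gj
    ... | tri≈ _ gi≡gj _ = contradiction (g-injective i<N j<N gi≡gj) i≢j
    ... | tri> _ _ gj≺gi = gj≺gi

    first-not-below : ∀ {a c} → a < c → g a ≺ g c →
      ∃[ t ] a < t × t ≤ c × ¬ (g t ≺ g c) × (∀ {i} → a ≤ i → i < t → g i ≺ g c)
    first-not-below {a} {c} a<c ga≺gc
      with minimal-witness (λ i → a ≤? i ×-dec ¬? (g i ≺? g c)) (<⇒≤ a<c , irrefl refl)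
    ... | t , t≤c , (a≤t , gt⊀gc) , before-t =
      t , ≤∧≢⇒< a≤t (λ { refl → gt⊀gc ga≺gc }) , t≤c , gt⊀gc ,
      λ a≤i i<t → decidable-stable (g _ ≺? g c) (λ gi⊀gc → before-t i<t (a≤i , gi⊀gc))

    below-or-inversion : ∀ a t b →
      Below _≺_ a t b ⊎ ∃[ p ] ∃[ q ] a ≤ p × p < t × t ≤ q × q < b × ¬ (g p ≺ g q)
    below-or-inversion a t b with anyUpTo? inversion-at? t
      where
      inversion-at? : Decidable (λ p → a ≤ p × ∃[ q ] q < b × t ≤ q × ¬ (g p ≺ g q))
      inversion-at? p = a ≤? p ×-dec anyUpTo? (λ q → t ≤? q ×-dec ¬? (g p ≺? g q)) b
    ... | yes (p , p<t , a≤p , q , q<b , t≤q , gp⊀gq) = inj₂ (p , q , a≤p , p<t , t≤q , q<b , gp⊀gq)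
    ... | no ¬∃ = inj₁ λ a≤p p<t t≤q q<b →
      decidable-stable (g _ ≺? g _) λ gp⊀gq → ¬∃ (_ , p<t , a≤p , _ , q<b , t≤q , gp⊀gq)

    occurrence-of-inversion : ∀ {p t q c} → p < t → t ≤ q → q ≤ c → c < N →
      g p ≺ g c → ¬ (g t ≺ g c) → ¬ (g p ≺ g q) → Occurrence _≺_
    occurrence-of-inversion {p} {t} {q} {c} p<t t≤q q≤c c<N gp≺gc gt⊀gc gp⊀gq =
      p , t , q , c , p<t , t<q , q<c , c<N , gq≺gp , gp≺gc , gc≺gt
      where
      q<N : q < N
      q<N = ≤-<-trans q≤c c<N
      gq≺gp : g q ≺ g p
      gq≺gp = ≺-connex (<-trans (<-≤-trans p<t t≤q) q<N) q<N (<⇒≢ (<-≤-trans p<t t≤q)) gp⊀gq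
      q<c : q < c
      q<c = ≤∧≢⇒< q≤c λ { refl → asym gp≺gc gq≺gp }
      gc≺gt : g c ≺ g t
      gc≺gt = ≺-connex (≤-<-trans t≤q q<N) c<N (<⇒≢ (≤-<-trans t≤q q<c)) gt⊀gc
      t<q : t < q
      t<q = ≤∧≢⇒< t≤q λ { refl → asym gc≺gt (≺-trans gq≺gp gp≺gc) }

    below-or-occurrence : ∀ {a c} → a < c → c < N → g a ≺ g c →
      (∃[ t ] a < t × t ≤ c × Below _≺_ a t (suc c)) ⊎ Occurrence _≺_
    below-or-occurrence {a} {c} a<c c<N ga≺gc with first-not-below a<c ga≺gc
    ... | t , a<t , t≤c , gt⊀gc , before-t with below-or-inversion a t (suc c)
    ...   | inj₁ below = inj₁ (t , a<t , t≤c , below)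
    ...   | inj₂ (p , q , a≤p , p<t , t≤q , q<1+c , gp⊀gq) =
      inj₂ (occurrence-of-inversion p<t t≤q (s≤s⁻¹ q<1+c) c<N (before-t a≤p p<t) gt⊀gc gp⊀gq)

  module Ascending = Oriented <-isStrictTotalOrder
  module Descending = Oriented (Flip.isStrictTotalOrder <-isStrictTotalOrder)

  separated-or-occurrence : ∀ {a c} → a < c → c < N →
    (∃[ t ] a < t × t ≤ c × Separated a t (suc c)) ⊎ (Occurrence _<_ ⊎ Occurrence (flip _<_))
  separated-or-occurrence {a} {c} a<c c<N with <-cmp (g a) (g c)
  ... | tri≈ _ ga≡gc _ = contradiction (g-injective (<-trans a<c c<N) c<N ga≡gc) (<⇒≢ a<c)
  ... | tri< ga<gc _ _ with Ascending.below-or-occurrence a<c c<N ga<gc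
  ...   | inj₁ (t , a<t , t≤c , below) = inj₁ (t , a<t , t≤c , inj₁ below)
  ...   | inj₂ occurrence = inj₂ (inj₁ occurrence)
  separated-or-occurrence a<c c<N | tri> _ _ gc<ga with Descending.below-or-occurrence a<c c<N gc<ga
  ...   | inj₁ (t , a<t , t≤c , above) = inj₁ (t , a<t , t≤c , inj₂ above)
  ...   | inj₂ occurrence = inj₂ (inj₂ occurrence)

  interval-left : ∀ {a t b} → IsInterval a b → Separated a t b → t ≤ b → IsInterval a t
  interval-left {t = t} interval separated t≤b {i} {j} a≤i i<t a≤j j<t gi<z z<gj
    with interval a≤i (<-≤-trans i<t t≤b) a≤j (<-≤-trans j<t t≤b) gi<z z<gj
  ... | k , a≤k , k<b , gk≡z with k <? t | separated
  ...   | yes k<t | _ = k , a≤k , k<t , gk≡z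
  ...   | no k≮t | inj₁ below =
    contradiction (subst (g j <_) gk≡z (below a≤j j<t (≮⇒≥ k≮t) k<b)) (<-asym z<gj)
  ...   | no k≮t | inj₂ above =
    contradiction (subst (_< g i) gk≡z (above a≤i i<t (≮⇒≥ k≮t) k<b)) (<-asym gi<z)

  interval-right : ∀ {a t b} → IsInterval a b → Separated a t b → a ≤ t → IsInterval t b
  interval-right {t = t} interval separated a≤t {i} {j} t≤i i<b t≤j j<b gi<z z<gj
    with interval (≤-trans a≤t t≤i) i<b (≤-trans a≤t t≤j) j<b gi<z z<gj
  ... | k , a≤k , k<b , gk≡z with k <? t | separated
  ...   | no k≮t | _ = k , ≮⇒≥ k≮t , k<b , gk≡z
  ...   | yes k<t | inj₁ below =
    contradiction (subst (_< g i) gk≡z (below a≤k k<t t≤i i<b)) (<-asym gi<z)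
  ...   | yes k<t | inj₂ above =
    contradiction (subst (g j <_) gk≡z (above a≤k k<t t≤j j<b)) (<-asym z<gj)

  interval-successor : ∀ {a b i j} → IsInterval a b → a ≤ i → i < b → a ≤ j → j < b →
    (∀ {k} → a ≤ k → k < b → k ≡ i ⊎ k ≡ j) → g i < g j → g j ≡ suc (g i)
  interval-successor interval a≤i i<b a≤j j<b only-i-j gi<gj with m≤n⇒m<n∨m≡n gi<gj
  ... | inj₂ 1+gi≡gj = sym 1+gi≡gj
  ... | inj₁ 1+gi<gj with interval a≤i i<b a≤j j<b (n<1+n _) 1+gi<gj
  ...   | k , a≤k , k<b , gk≡1+gi with only-i-j a≤k k<b
  ...     | inj₁ refl = contradiction (n<1+n _) (<-irrefl gk≡1+gi)
  ...     | inj₂ refl = contradiction 1+gi<gj (<-irrefl (sym gk≡1+gi))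

  two-positions : ∀ {a k} → a ≤ k → k < 2 + a → k ≡ a ⊎ k ≡ suc a
  two-positions a≤k k<2+a with m≤n⇒m<n∨m≡n a≤k
  ... | inj₂ refl = inj₁ refl
  ... | inj₁ a<k = inj₂ (≤-antisym (s≤s⁻¹ k<2+a) a<k)

  interval-pair-consecutive : ∀ {a} → IsInterval a (2 + a) → 2 + a ≤ N → Consecutive (g a) (g (suc a))
  interval-pair-consecutive {a} interval 2+a≤N with <-cmp (g a) (g (suc a))
  ... | tri< ga<g1+a _ _ =
    inj₁ (interval-successor interval ≤-refl (n≤1+n (suc a)) (n≤1+n a) ≤-refl two-positions ga<g1+a)
  ... | tri≈ _ ga≡g1+a _ =
    contradiction (g-injective (<-trans (n<1+n a) 2+a≤N) 2+a≤N ga≡g1+a) (<⇒≢ (n<1+n a))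
  ... | tri> _ _ g1+a<ga =
    inj₂ (interval-successor interval (n≤1+n a) ≤-refl ≤-refl (n≤1+n (suc a))
            (λ a≤k k<2+a → swap (two-positions a≤k k<2+a)) g1+a<ga)

  adjacent-or-occurrence : 2 ≤ N → IsInterval 0 N →
    AdjacentConsecutive ⊎ (Occurrence _<_ ⊎ Occurrence (flip _<_))
  adjacent-or-occurrence 2≤N interval = descend N (≤-reflexive (sym (+-identityʳ N))) 2≤N ≤-refl interval
    where
    descend : ∀ fuel {a b} → b ≤ fuel + a → 2 + a ≤ b → b ≤ N → IsInterval a b →
      AdjacentConsecutive ⊎ (Occurrence _<_ ⊎ Occurrence (flip _<_))
    descend zero b≤a 2+a≤b _ _ = contradiction (≤-trans (n≤1+n _) (≤-trans 2+a≤b b≤a)) 1+n≰n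
    descend (suc fuel) {a} {suc c} b≤fuel+a 2+a≤b b≤N interval
      with separated-or-occurrence (s≤s⁻¹ 2+a≤b) b≤N
    ... | inj₂ occurrence = inj₂ occurrence
    ... | inj₁ (t , a<t , t≤c , separated) with 2 + a ≤? t | 2 + t ≤? suc c
    ...   | yes 2+a≤t | _ =
      descend fuel (≤-trans t≤c (s≤s⁻¹ b≤fuel+a)) 2+a≤t (≤-trans t≤c (<⇒≤ b≤N))
              (interval-left interval separated (≤-trans t≤c (n≤1+n c)))
    ...   | no _ | yes 2+t≤b =
      descend fuel t-bound 2+t≤b b≤N (interval-right interval separated (<⇒≤ a<t))
      where
      t-bound : suc c ≤ fuel + t
      t-bound = ≤-trans b≤fuel+a (≤-trans (≤-reflexive (sym (+-suc fuel a))) (+-monoʳ-≤ fuel a<t))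
    ...   | no 2+a≰t | no 2+t≰b =
      inj₁ (a , 2+a≤N , interval-pair-consecutive (subst (IsInterval a) b≡2+a interval) 2+a≤N)
      where
      b≡2+a : suc c ≡ 2 + a
      b≡2+a = cong suc (trans (≤-antisym (s≤s⁻¹ (s≤s⁻¹ (≰⇒> 2+t≰b))) t≤c)
                              (≤-antisym (s≤s⁻¹ (≰⇒> 2+a≰t)) a<t))
      2+a≤N : 2 + a ≤ N
      2+a≤N = subst (_≤ N) b≡2+a b≤N

val-injective : ∀ {n} (σ : Permutation′ n) {a b} → val σ a ≡ val σ b → a ≡ b
val-injective σ {a} {b} σa≡σb = begin
  a                 ≡⟨ inverseˡ σ ⟨
  σ ⟨$⟩ˡ (σ ⟨$⟩ʳ a) ≡⟨ cong (σ ⟨$⟩ˡ_) (toℕ-injective σa≡σb) ⟩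
  σ ⟨$⟩ˡ (σ ⟨$⟩ʳ b) ≡⟨ inverseˡ σ ⟩
  b                 ∎
  where open ≡-Reasoning

⪯-intro : ∀ {k n} (p : Permutation′ k) (σ : Permutation′ n) (f : Fin k → Fin n) →
  (∀ a b → toℕ a < toℕ b → toℕ (f a) < toℕ (f b)) →
  (∀ a b → val p a < val p b → val σ (f a) < val σ (f b)) → p ⪯ σ
⪯-intro p σ f f-increasing preserves = f , f-increasing , λ a b → mk⇔ (preserves a b) (reflects a b)
  where
  reflects : ∀ a b → val σ (f a) < val σ (f b) → val p a < val p b
  reflects a b σfa<σfb with <-cmp (val p a) (val p b)
  ... | tri< pa<pb _ _ = pa<pb
  ... | tri≈ _ pa≡pb _ = contradiction σfa<σfb (<-irrefl (cong (val σ ∘ f) (val-injective p pa≡pb)))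
  ... | tri> _ _ pb<pa = contradiction (preserves b a pb<pa) (<-asym σfa<σfb)

Increasing₄ : (Fin 4 → ℕ) → Set
Increasing₄ h = h 0F < h 1F × h 1F < h 2F × h 2F < h 3F

increasing₄ : (h : Fin 4 → ℕ) → Increasing₄ h → ∀ a b → toℕ a < toℕ b → h a < h b
increasing₄ h (h₀<h₁ , h₁<h₂ , h₂<h₃) 0F 1F _ = h₀<h₁
increasing₄ h (h₀<h₁ , h₁<h₂ , h₂<h₃) 0F 2F _ = <-trans h₀<h₁ h₁<h₂
increasing₄ h (h₀<h₁ , h₁<h₂ , h₂<h₃) 0F 3F _ = <-trans h₀<h₁ (<-trans h₁<h₂ h₂<h₃)
increasing₄ h (h₀<h₁ , h₁<h₂ , h₂<h₃) 1F 2F _ = h₁<h₂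
increasing₄ h (h₀<h₁ , h₁<h₂ , h₂<h₃) 1F 3F _ = <-trans h₁<h₂ h₂<h₃
increasing₄ h (h₀<h₁ , h₁<h₂ , h₂<h₃) 2F 3F _ = h₂<h₃
increasing₄ _ _ 0F 0F ()
increasing₄ _ _ 1F 0F ()
increasing₄ _ _ 1F 1F (s≤s ())
increasing₄ _ _ 2F 0F ()
increasing₄ _ _ 2F 1F (s≤s ())
increasing₄ _ _ 2F 2F (s≤s (s≤s ()))
increasing₄ _ _ 3F 0F ()
increasing₄ _ _ 3F 1F (s≤s ())
increasing₄ _ _ 3F 2F (s≤s (s≤s ()))
increasing₄ _ _ 3F 3F (s≤s (s≤s (s≤s ())))

Increasing₄-cong : ∀ {h h′} → (∀ a → h a ≡ h′ a) → Increasing₄ h → Increasing₄ h′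
Increasing₄-cong h≗h′ (h₀<h₁ , h₁<h₂ , h₂<h₃) =
  subst₂ _<_ (h≗h′ 0F) (h≗h′ 1F) h₀<h₁ ,
  subst₂ _<_ (h≗h′ 1F) (h≗h′ 2F) h₁<h₂ ,
  subst₂ _<_ (h≗h′ 2F) (h≗h′ 3F) h₂<h₃

-- Listing the entries of σ ∘ f in the order p⁻¹, i.e. by their rank in p,
-- reduces order-isomorphism to one increasing chain.
⪯-of-increasing : ∀ {n} (p : Permutation′ 4) (σ : Permutation′ n) (f : Fin 4 → Fin n) →
  Increasing₄ (toℕ ∘ f) → Increasing₄ (val σ ∘ f ∘ (p ⟨$⟩ˡ_)) → p ⪯ σ
⪯-of-increasing p σ f positions values = ⪯-intro p σ f (increasing₄ (toℕ ∘ f) positions) preserves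
  where
  preserves : ∀ a b → val p a < val p b → val σ (f a) < val σ (f b)
  preserves a b pa<pb =
    subst₂ (λ x y → val σ (f x) < val σ (f y)) (inverseˡ p) (inverseˡ p)
      (increasing₄ (val σ ∘ f ∘ (p ⟨$⟩ˡ_)) values _ _ pa<pb)

-- The padding 0 beyond position n is never read: every segment used lies in [0, n).
entry : ∀ {n} → Permutation′ n → ℕ → ℕ
entry {n} σ i with i <? n
... | yes i<n = val σ (fromℕ< i<n)
... | no _ = 0

module _ {n} (σ : Permutation′ n) where

  entry-val : ∀ {i} (i<n : i < n) → entry σ i ≡ val σ (fromℕ< i<n)
  entry-val {i} i<n with i <? n
  ... | yes _ = refl
  ... | no i≮n = contradiction i<n i≮n

  entry-injective : ∀ {i j} → i < n → j < n → entry σ i ≡ entry σ j → i ≡ j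
  entry-injective {i} {j} i<n j<n σi≡σj = begin
    i                 ≡⟨ toℕ-fromℕ< i<n ⟨
    toℕ (fromℕ< i<n) ≡⟨ cong toℕ (val-injective σ σ[i]≡σ[j]) ⟩
    toℕ (fromℕ< j<n) ≡⟨ toℕ-fromℕ< j<n ⟩
    j                 ∎
    where
    open ≡-Reasoning
    σ[i]≡σ[j] : val σ (fromℕ< i<n) ≡ val σ (fromℕ< j<n)
    σ[i]≡σ[j] = trans (sym (entry-val i<n)) (trans σi≡σj (entry-val j<n))

  open Segments (entry σ) n entry-injective

  entry-interval : IsInterval 0 n
  entry-interval {j = j} _ _ _ j<n _ z<σj = toℕ (σ ⟨$⟩ˡ w) , z≤n , toℕ<n _ , σ⁻¹w-entry
    where
    z<n : _ < n
    z<n = <-trans z<σj (subst (_< n) (sym (entry-val j<n)) (toℕ<n _))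
    w : Fin n
    w = fromℕ< z<n
    σ⁻¹w-entry : entry σ (toℕ (σ ⟨$⟩ˡ w)) ≡ _
    σ⁻¹w-entry = begin
      entry σ (toℕ (σ ⟨$⟩ˡ w))                  ≡⟨ entry-val (toℕ<n _) ⟩
      val σ (fromℕ< (toℕ<n (σ ⟨$⟩ˡ w)))          ≡⟨ cong (val σ) (fromℕ<-toℕ _ (toℕ<n _)) ⟩
      toℕ (σ ⟨$⟩ʳ (σ ⟨$⟩ˡ w))                   ≡⟨ cong toℕ (inverseʳ σ) ⟩
      toℕ w                                      ≡⟨ toℕ-fromℕ< z<n ⟩
      _                                          ∎
      where open ≡-Reasoning

  king⇒¬adjacentConsecutive : IsKing σ → ¬ AdjacentConsecutive
  king⇒¬adjacentConsecutive king (i , 1+i<n , consecutive) =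
    king (fromℕ< i<n) (fromℕ< 1+i<n) positions
      (subst₂ (λ x y → ∣ x - y ∣ ≡ 1) (entry-val 1+i<n) (entry-val i<n) (consecutive⇒∣-∣≡1 consecutive))
    where
    i<n : i < n
    i<n = <-trans (n<1+n i) 1+i<n
    positions : toℕ (fromℕ< 1+i<n) ≡ suc (toℕ (fromℕ< i<n))
    positions = trans (toℕ-fromℕ< 1+i<n) (cong suc (sym (toℕ-fromℕ< i<n)))

  ⪯-of-positions : (p : Permutation′ 4) (pos : Fin 4 → ℕ) → Increasing₄ pos → pos 3F < n →
    Increasing₄ (entry σ ∘ pos ∘ (p ⟨$⟩ˡ_)) → p ⪯ σ
  ⪯-of-positions p pos pos-increasing pos₃<n values =
    ⪯-of-increasing p σ (λ a → fromℕ< (pos<n a))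
      (Increasing₄-cong (λ a → sym (toℕ-fromℕ< (pos<n a))) pos-increasing)
      (Increasing₄-cong (λ a → entry-val (pos<n (p ⟨$⟩ˡ a))) values)
    where
    pos<n : ∀ a → pos a < n
    pos<n 0F = <-trans (increasing₄ pos pos-increasing 0F 3F (s≤s z≤n)) pos₃<n
    pos<n 1F = <-trans (increasing₄ pos pos-increasing 1F 3F (s≤s (s≤s z≤n))) pos₃<n
    pos<n 2F = <-trans (increasing₄ pos pos-increasing 2F 3F (s≤s (s≤s (s≤s z≤n)))) pos₃<n
    pos<n 3F = pos₃<n

  adjacentConsecutive-or-pattern : 2 ≤ n → AdjacentConsecutive ⊎ (p2413 ⪯ σ ⊎ p3142 ⪯ σ)
  adjacentConsecutive-or-pattern 2≤n with adjacent-or-occurrence 2≤n entry-interval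
  ... | inj₁ adjacent = inj₁ adjacent
  ... | inj₂ (inj₁ (i , j , k , l , i<j , j<k , k<l , l<n , σk<σi , σi<σl , σl<σj)) =
    inj₂ (inj₁ (⪯-of-positions p2413 (lookup (i ∷ j ∷ k ∷ l ∷ [])) (i<j , j<k , k<l) l<n
                                (σk<σi , σi<σl , σl<σj)))
  ... | inj₂ (inj₂ (i , j , k , l , i<j , j<k , k<l , l<n , σi<σk , σl<σi , σj<σl)) =
    inj₂ (inj₂ (⪯-of-positions p3142 (lookup (i ∷ j ∷ k ∷ l ∷ [])) (i<j , j<k , k<l) l<n
                                (σj<σl , σl<σi , σi<σk)))

mainTheorem1 : (n : ℕ) → 4 ≤ n → (π : Permutation′ n) → IsKing π →
    (p2413 ⪯ π) ⊎ (p3142 ⪯ π)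
mainTheorem1 n 4≤n π king with adjacentConsecutive-or-pattern π (≤-trans (s≤s (s≤s z≤n)) 4≤n)
... | inj₁ adjacent = ⊥-elim (king⇒¬adjacentConsecutive π king adjacent)
... | inj₂ contains = contains
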